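{- Let $d\ge 1$, let $g:\mathbb{N}\to\mathbb{N}$ be monotone and expansive, and let $n_0\in\mathbb{N}$. If $D_0\supsetneq D_1\supsetneq\cdots\supsetneq D_\ell$ is a $(g,n_0)$-controlled strongly monotone descending chain of downwards-closed subsets of $\mathbb{N}^d$, then $\ell\le L_d+1$.
   Context: $\mathbb{N}^d$ is ordered componentwise by $\sqsubseteq$; downwards-closed sets are sets $D$ with $x\in D$, $y\sqsubseteq x\Rightarrow y\in D$. With $\mathbb{N}_\omega=\mathbb{N}\cup\{\omega\}$, the order ideals of $\mathbb{N}^d$ (non-empty directed downwards-closed sets) are the sets $\{x\in\mathbb{N}^d: x\sqsubseteq v\}$, $v\in\mathbb{N}_\omega^d$, identified with $v$. For an ideal $I$: $\omega(I)=\{i: I(i)=\omega\}$, $\mathrm{fin}(I)$ its complement in $\{1,\dots,d\}$, $\dim I=|\omega(I)|$, $\|I\|=\max_{i\in\mathrm{fin}(I)}I(i)$ ($0$ if empty). Each downwards-closed $D$ is uniquely a finite union of pairwise incomparable ideals (canonical decomposition); $I\in D$ means $I$ is in it, and $\|D\|=\max_{I\in D}\|I\|$. An ideal is proper at step $k$ of a descending chain if $I\in D_k$, $I\notin D_{k+1}$. The chain is strongly monotone if whenever $I$ is proper at step $k+1$ there is $I'$ proper at step $k$ with $\dim I\le\dim I'$. It is $(g,n_0)$-controlled (for $g$ monotone and expansive, i.e. $x\le g(x)$) if $\|D_k\|\le g^k(n_0)$ for all $k$. Define $N_0=n_0$, $L_0=0$, and for $0\le i<d$: $N_{i+1}=g^{L_i+1}(n_0)$,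 $L_{i+1}=L_i+\prod_{1\le j\le i+1}(d-j+1)(N_j+1)$. -}

module Defs where

open import Data.Nat using (ℕ; zero; suc; _+_; _*_; _∸_; _≤_; _<_; _⊔_)
open import Data.Vec using (Vec; []; _∷_; lookup)
open import Data.Fin using (Fin)
open import Data.List using (List; foldr; map)
open import Data.List.Relation.Unary.Any using (Any)
open import Data.List.Relation.Unary.AllPairs using (AllPairs)
open import Data.List.Membership.Propositional using (_∈_)
open import Data.Product using (_×_; ∃; ∃-syntax)
open import Relation.Nullary using (¬_)

data ℕω : Set where
  fin : ℕ → ℕω
  ω   : ℕω

infix 4 _≤ω_
data _≤ω_ : ℕω → ℕω → Set where
  fin≤fin : ∀ {m n} → m ≤ n → fin m ≤ω fin n
  ≤ω-top  : ∀ {a} → a ≤ω ω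

-- An order ideal of ℕ^d, identified with a vector v ∈ ℕ_ω^d
Ideal : ℕ → Set
Ideal d = Vec ℕω d

_∈ᴵ_ : ∀ {d} → Vec ℕ d → Ideal d → Set
_∈ᴵ_ {d} x I = ∀ (i : Fin d) → fin (lookup x i) ≤ω lookup I i

_⊑ᴵ_ : ∀ {d} → Ideal d → Ideal d → Set
_⊑ᴵ_ {d} I J = ∀ (i : Fin d) → lookup I i ≤ω lookup J i

dim : ∀ {d} → Ideal d → ℕ
dim []        = 0
dim (fin _ ∷ I) = dim I
dim (ω ∷ I)   = suc (dim I)

∥_∥ᴵ : ∀ {d} → Ideal d → ℕ
∥ [] ∥ᴵ        = 0
∥ fin n ∷ I ∥ᴵ = n ⊔ ∥ I ∥ᴵ
∥ ω ∷ I ∥ᴵ     = ∥ I ∥ᴵ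

-- A downwards-closed subset of ℕ^d, given by its canonical decomposition:
-- a finite list of pairwise incomparable ideals.
record DCS (d : ℕ) : Set where
  field
    ideals       : List (Ideal d)
    incomparable : AllPairs (λ I J → ¬ (I ⊑ᴵ J) × ¬ (J ⊑ᴵ I)) ideals
open DCS public

_∈ˢ_ : ∀ {d} → Vec ℕ d → DCS d → Set
x ∈ˢ D = Any (x ∈ᴵ_) (ideals D)

_∈ᶜ_ : ∀ {d} → Ideal d → DCS d → Set
I ∈ᶜ D = I ∈ ideals D

∥_∥ : ∀ {d} → DCS d → ℕ
∥ D ∥ = foldr _⊔_ 0 (map ∥_∥ᴵ (ideals D))

_⊊_ : ∀ {d} → DCS d → DCS d → Set
E ⊊ D = (∀ x → x ∈ˢ E → x ∈ˢ D) × (∃[ x ] (x ∈ˢ D × ¬ (x ∈ˢ E)))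

iter : (ℕ → ℕ) → ℕ → ℕ → ℕ
iter g zero    x = x
iter g (suc k) x = g (iter g k x)

Monotone : (ℕ → ℕ) → Set
Monotone g = ∀ {m n} → m ≤ n → g m ≤ g n

Expansive : (ℕ → ℕ) → Set
Expansive g = ∀ x → x ≤ g x

DescendingChain : ∀ {d} → (ℕ → DCS d) → ℕ → Set
DescendingChain D ℓ = ∀ k → k < ℓ → D (suc k) ⊊ D k

Proper : ∀ {d} → (ℕ → DCS d) → ℕ → Ideal d → Set
Proper D k I = I ∈ᶜ D k × ¬ (I ∈ᶜ D (suc k))

StronglyMonotone : ∀ {d} → (ℕ → DCS d) → ℕ → Set
StronglyMonotone D ℓ = ∀ k → suc k < ℓ → ∀ I → Proper D (suc k) I →
  ∃[ I' ] (Proper D k I' × dim I ≤ dim I')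

Controlled : ∀ {d} → (ℕ → ℕ) → ℕ → (ℕ → DCS d) → ℕ → Set
Controlled g n₀ D ℓ = ∀ k → k ≤ ℓ → ∥ D k ∥ ≤ iter g k n₀

mutual
  N : (d : ℕ) → (ℕ → ℕ) → ℕ → ℕ → ℕ
  N d g n₀ zero    = n₀
  N d g n₀ (suc i) = iter g (suc (L d g n₀ i)) n₀

  L : (d : ℕ) → (ℕ → ℕ) → ℕ → ℕ → ℕ
  L d g n₀ zero    = 0
  L d g n₀ (suc i) = L d g n₀ i + P d g n₀ (suc i)

  P : (d : ℕ) → (ℕ → ℕ) → ℕ → ℕ → ℕ
  P d g n₀ zero    = 1
  P d g n₀ (suc m) = P d g n₀ m * ((d ∸ m) * (N d g n₀ (suc m) + 1))

module Submission where

-- By induction on i, every ideal proper at a step k > L i has dimension below d ∸ i. Suppose an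
-- ideal proper at k > L (i + 1) had dimension d ∸ (i + 1). Strong monotonicity propagates it back
-- to proper ideals of dimension at least (hence, by induction, exactly) d ∸ (i + 1) at each of the
-- P (i + 1) + 1 steps L i + 1, …, L (i + 1) + 1, and these are pairwise distinct because an ideal
-- is proper at one step only. Each such ideal J is pinned down by its ancestors in D (L j + 1),
-- j ≤ i: the ancestor has dimension below d ∸ j and, by control, finite entries at most N (j + 1),
-- so it exposes a new finite coordinate of J bounded by N (j + 1). Hence J is among
-- ∏ j≤i (d ∸ j) (N (j + 1) + 1) = P (i + 1) candidates, a contradiction. At i = d no proper ideal
-- remains after step L d, so ℓ ≤ L d + 1.

open import Defs
open import Data.Nat using (ℕ; zero; suc; _+_; _*_; _∸_; _≤_; _<_; _⊔_; z≤n; s≤s; _≤′_; ≤′-reflexive; ≤′-step)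
open import Data.Nat.Properties
open import Data.Nat.Induction using (<-rec)
open import Data.Fin using (Fin; zero; suc; toℕ)
open import Data.Fin.Properties using (any?; all?; ¬∀⟶∃¬; toℕ-injective; toℕ≤pred[n]) renaming (_≟_ to _≟ᶠ_)
import Data.Vec as Vec
open import Data.Vec using (Vec; []; _∷_; lookup; replicate; _[_]≔_)
open import Data.Vec.Properties using (lookup∘update; lookup∘update′; lookup-replicate; lookup-map; tabulate∘lookup; tabulate-cong; ≡-dec)
import Data.List as List
open import Data.List using (List; []; _∷_; length; concatMap; cartesianProductWith; upTo; foldr)
open import Data.List.Properties using (length-map; length-++; length-upTo; length-tabulate; length-removeAt′)
open import Data.List.Relation.Unary.Any as Any using (Any; here; there; _─_)
import Data.List.Relation.Unary.All as All
open import Data.List.Relation.Unary.AllPairs using (AllPairs; []; _∷_)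
open import Data.List.Relation.Unary.Unique.Propositional using (Unique)
open import Data.List.Relation.Unary.Unique.Propositional.Properties using (tabulate⁺)
open import Data.List.Membership.Propositional using (_∈_; find; lose)
open import Data.List.Membership.Propositional.Properties
  using (∈-map⁺; ∈-map⁻; ∈-concatMap⁺; ∈-concatMap⁻; ∈-cartesianProductWith⁺; ∈-cartesianProductWith⁻; ∈-upTo⁺; ∈-tabulate⁻)
open import Data.Product using (∃-syntax; _×_; _,_; proj₁; proj₂)
open import Data.Sum using (_⊎_; inj₁; inj₂)
open import Relation.Nullary using (¬_; Dec; yes; no; contradiction; ¬?)
open import Relation.Binary.Definitions using (tri<; tri≈; tri>)
open import Relation.Nullary.Decidable using (_×-dec_; decidable-stable)
open import Relation.Binary.PropositionalEquality
open import Function using (_∘_)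

private
  variable
    d : ℕ

module _ {A : Set} where

  ∈-─ : {x y : A} {ys : List A} (x∈ : x ∈ ys) → y ∈ ys → y ≢ x → y ∈ (ys ─ x∈)
  ∈-─ (here refl) (here refl) y≢x = contradiction refl y≢x
  ∈-─ (here refl) (there y∈)  _   = y∈
  ∈-─ (there x∈)  (here refl) _   = here refl
  ∈-─ (there x∈)  (there y∈)  y≢x = there (∈-─ x∈ y∈ y≢x)

  Unique-⊆⇒length≤ : {xs ys : List A} → Unique xs → (∀ {x} → x ∈ xs → x ∈ ys) → length xs ≤ length ys
  Unique-⊆⇒length≤ []                   _  = z≤n
  Unique-⊆⇒length≤ {x ∷ xs} {ys} (x∉ ∷ uniq) xs⊆ys = begin
    suc (length xs)                  ≤⟨ s≤s (Unique-⊆⇒length≤ uniq tail⊆) ⟩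
    suc (length (ys ─ x∈ys))         ≡⟨ length-removeAt′ ys (Any.index x∈ys) ⟨
    length ys                        ∎
    where
      open ≤-Reasoning
      x∈ys = xs⊆ys (here refl)
      tail⊆ : ∀ {y} → y ∈ xs → y ∈ (ys ─ x∈ys)
      tail⊆ y∈ = ∈-─ x∈ys (xs⊆ys (there y∈)) (λ y≡x → All.lookup x∉ y∈ (sym y≡x))

  injection⇒≤length : ∀ {n} {f : Fin n → A} {ys : List A} →
                      (∀ {i j} → f i ≡ f j → i ≡ j) → (∀ i → f i ∈ ys) → n ≤ length ys
  injection⇒≤length {n} {f} {ys} f-inj f∈ys = begin
    n                        ≡⟨ length-tabulate f ⟨
    length (List.tabulate f) ≤⟨ Unique-⊆⇒length≤ (tabulate⁺ f-inj) tabulate⊆ ⟩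
    length ys                ∎
    where
      open ≤-Reasoning
      tabulate⊆ : ∀ {x} → x ∈ List.tabulate f → x ∈ ys
      tabulate⊆ x∈ with i , refl ← ∈-tabulate⁻ x∈ = f∈ys i

  length-concatMap : {B : Set} (f : A → List B) (xs : List A) {n : ℕ} →
                     (∀ {x} → x ∈ xs → length (f x) ≡ n) → length (concatMap f xs) ≡ length xs * n
  length-concatMap f []       _      = refl
  length-concatMap f (x ∷ xs) length≡ =
    trans (length-++ (f x)) (cong₂ _+_ (length≡ (here refl)) (length-concatMap f xs (length≡ ∘ there)))

  length-cartesianProductWith : {B C : Set} (f : A → B → C) (xs : List A) (ys : List B) →
                                length (cartesianProductWith f xs ys) ≡ length xs * length ys
  length-cartesianProductWith f []       ys = refl
  length-cartesianProductWith f (x ∷ xs) ys =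
    trans (length-++ (List.map (f x) ys))
          (cong₂ _+_ (length-map (f x) ys) (length-cartesianProductWith f xs ys))

≤ω-refl : ∀ {a} → a ≤ω a
≤ω-refl {fin n} = fin≤fin ≤-refl
≤ω-refl {ω}     = ≤ω-top

≤ω-trans : ∀ {a b c} → a ≤ω b → b ≤ω c → a ≤ω c
≤ω-trans _           ≤ω-top      = ≤ω-top
≤ω-trans (fin≤fin p) (fin≤fin q) = fin≤fin (≤-trans p q)

≤ω-antisym : ∀ {a b} → a ≤ω b → b ≤ω a → a ≡ b
≤ω-antisym (fin≤fin p) (fin≤fin q) = cong fin (≤-antisym p q)
≤ω-antisym ≤ω-top      ≤ω-top      = refl

_≤ω?_ : (a b : ℕω) → Dec (a ≤ω b)
a     ≤ω? ω     = yes ≤ω-top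
ω     ≤ω? fin n = no λ ()
fin m ≤ω? fin n with m ≤? n
... | yes m≤n = yes (fin≤fin m≤n)
... | no  m≰n = no λ { (fin≤fin m≤n) → m≰n m≤n }

_≟ω_ : (a b : ℕω) → Dec (a ≡ b)
fin m ≟ω fin n with m Data.Nat.≟ n
... | yes refl = yes refl
... | no  m≢n  = no λ { refl → m≢n refl }
fin m ≟ω ω     = no λ ()
ω     ≟ω fin n = no λ ()
ω     ≟ω ω     = yes refl

≢ω⇒fin : ∀ {a} → a ≢ ω → ∃[ n ] a ≡ fin n
≢ω⇒fin {fin n} _   = n , refl
≢ω⇒fin {ω}     a≢ω = contradiction refl a≢ω

≤ω-fin : ∀ {a n} → a ≤ω fin n → ∃[ m ] a ≡ fin m × m ≤ n
≤ω-fin (fin≤fin {m} m≤n) = m , refl , m≤n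

⊑ᴵ-trans : {I J K : Ideal d} → I ⊑ᴵ J → J ⊑ᴵ K → I ⊑ᴵ K
⊑ᴵ-trans I⊑J J⊑K i = ≤ω-trans (I⊑J i) (J⊑K i)

⊑ᴵ-antisym : {I J : Ideal d} → I ⊑ᴵ J → J ⊑ᴵ I → I ≡ J
⊑ᴵ-antisym {I = I} {J} I⊑J J⊑I =
  trans (sym (tabulate∘lookup I))
        (trans (tabulate-cong (λ i → ≤ω-antisym (I⊑J i) (J⊑I i))) (tabulate∘lookup J))

_⊑ᴵ?_ : (I J : Ideal d) → Dec (I ⊑ᴵ J)
I ⊑ᴵ? J = all? (λ i → lookup I i ≤ω? lookup J i)

_≟ᴵ_ : (I J : Ideal d) → Dec (I ≡ J)
_≟ᴵ_ = ≡-dec _≟ω_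

⊑ᴵ-update : {I J : Ideal d} {c : Fin d} {a : ℕω} →
            I ⊑ᴵ J → lookup I c ≤ω a → I ⊑ᴵ (J [ c ]≔ a)
⊑ᴵ-update {J = J} {c} {a} I⊑J Ic≤a c′ with c′ ≟ᶠ c
... | yes refl = subst (_ ≤ω_) (sym (lookup∘update c J a)) Ic≤a
... | no  c′≢c = subst (_ ≤ω_) (sym (lookup∘update′ c′≢c J a)) (I⊑J c′)

lookup≡fin⇒≤∥∥ᴵ : (I : Ideal d) (i : Fin d) {m : ℕ} → lookup I i ≡ fin m → m ≤ ∥ I ∥ᴵ
lookup≡fin⇒≤∥∥ᴵ (fin n ∷ I) zero    refl = m≤m⊔n n _
lookup≡fin⇒≤∥∥ᴵ (fin n ∷ I) (suc i) e    = ≤-trans (lookup≡fin⇒≤∥∥ᴵ I i e) (m≤n⊔m n _)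
lookup≡fin⇒≤∥∥ᴵ (ω ∷ I)     (suc i) e    = lookup≡fin⇒≤∥∥ᴵ I i e

∈⇒∥∥ᴵ≤max : {J : Ideal d} {Js : List (Ideal d)} → J ∈ Js → ∥ J ∥ᴵ ≤ foldr _⊔_ 0 (List.map ∥_∥ᴵ Js)
∈⇒∥∥ᴵ≤max (here refl)         = m≤m⊔n _ _
∈⇒∥∥ᴵ≤max {Js = K ∷ _} (there J∈) = ≤-trans (∈⇒∥∥ᴵ≤max J∈) (m≤n⊔m ∥ K ∥ᴵ _)

-- Replacing every ω of I by B gives a point of I that escapes every ideal J ⋣ I with ∥ J ∥ᴵ < B.
replaceω : ℕ → ℕω → ℕ
replaceω B (fin n) = n
replaceω B ω       = B

point : Ideal d → ℕ → Vec ℕ d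
point I B = Vec.map (replaceω B) I

point∈ᴵ : (I : Ideal d) (B : ℕ) → point I B ∈ᴵ I
point∈ᴵ I B i rewrite lookup-map i (replaceω B) I with lookup I i
... | fin n = ≤ω-refl
... | ω     = ≤ω-top

point∉ᴵ : (I J : Ideal d) (B : ℕ) → ¬ I ⊑ᴵ J → ∥ J ∥ᴵ < B → ¬ point I B ∈ᴵ J
point∉ᴵ {d} I J B I⋢J ∥J∥<B x∈J
  with i , Ii≰Ji ← ¬∀⟶∃¬ d _ (λ i → lookup I i ≤ω? lookup J i) I⋢J =
  escape (lookup I i) (lookup J i) Ii≰Ji (λ Ji≡ → ≤-<-trans (lookup≡fin⇒≤∥∥ᴵ J i Ji≡) ∥J∥<B)
    (subst (λ z → fin z ≤ω lookup J i) (lookup-map i (replaceω B) I) (x∈J i))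
  where
    escape : ∀ a b → ¬ a ≤ω b → (∀ {m} → b ≡ fin m → m < B) → ¬ fin (replaceω B a) ≤ω b
    escape _       ω       a≰b _   _               = a≰b ≤ω-top
    escape (fin n) (fin m) a≰b _   n≤m             = a≰b n≤m
    escape ω       (fin m) _   m<B (fin≤fin B≤m)   = <⇒≱ (m<B refl) B≤m

⊆⋃⇒⊑ᴵ-any : (I : Ideal d) (Js : List (Ideal d)) →
             (∀ x → x ∈ᴵ I → Any (x ∈ᴵ_) Js) → Any (I ⊑ᴵ_) Js
⊆⋃⇒⊑ᴵ-any I Js I⊆Js with Any.any? (I ⊑ᴵ?_) Js
... | yes I⊑J = I⊑J
... | no  I⋢Js = contradiction (I⊆Js (point I B) (point∈ᴵ I B)) (escapes Js ≤-refl I⋢Js)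
  where
    B = suc (foldr _⊔_ 0 (List.map ∥_∥ᴵ Js))
    escapes : ∀ Ks → foldr _⊔_ 0 (List.map ∥_∥ᴵ Ks) < B → ¬ Any (I ⊑ᴵ_) Ks → ¬ Any (point I B ∈ᴵ_) Ks
    escapes (K ∷ Ks) lt I⋢Ks (here x∈K) =
      point∉ᴵ I K B (I⋢Ks ∘ here) (≤-<-trans (m≤m⊔n _ _) lt) x∈K
    escapes (K ∷ Ks) lt I⋢Ks (there x∈Ks) =
      escapes Ks (≤-<-trans (m≤n⊔m ∥ K ∥ᴵ _) lt) (I⋢Ks ∘ there) x∈Ks

AllPairs-∈ : {A : Set} {R : A → A → Set} {xs : List A} {x y : A} →
             AllPairs R xs → x ∈ xs → y ∈ xs → x ≡ y ⊎ R x y ⊎ R y x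
AllPairs-∈ (_   ∷ _)  (here refl) (here refl) = inj₁ refl
AllPairs-∈ (Rx ∷ _)   (here refl) (there y∈)  = inj₂ (inj₁ (All.lookup Rx y∈))
AllPairs-∈ (Rx ∷ _)   (there x∈)  (here refl) = inj₂ (inj₂ (All.lookup Rx x∈))
AllPairs-∈ (_  ∷ Rxs) (there x∈)  (there y∈)  = AllPairs-∈ Rxs x∈ y∈

∈ᶜ-antichain : (E : DCS d) {I J : Ideal d} → I ∈ᶜ E → J ∈ᶜ E → I ⊑ᴵ J → I ≡ J
∈ᶜ-antichain E I∈ J∈ I⊑J with AllPairs-∈ (incomparable E) I∈ J∈
... | inj₁ I≡J               = I≡J
... | inj₂ (inj₁ (I⋢J , _))  = contradiction I⊑J I⋢J
... | inj₂ (inj₂ (_ , I⋢J))  = contradiction I⊑J I⋢J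

∈ᶜ⇒⊆ : (E : DCS d) {I : Ideal d} → I ∈ᶜ E → (x : Vec ℕ d) → x ∈ᴵ I → x ∈ˢ E
∈ᶜ⇒⊆ E I∈ x x∈I = Any.map (λ { refl → x∈I }) I∈

_∈ᶜ?_ : (I : Ideal d) (E : DCS d) → Dec (I ∈ᶜ E)
I ∈ᶜ? E = Any.any? (I ≟ᴵ_) (ideals E)

dim≤ : (I : Ideal d) → dim I ≤ d
dim≤ []          = z≤n
dim≤ (fin _ ∷ I) = m≤n⇒m≤1+n (dim≤ I)
dim≤ (ω ∷ I)     = s≤s (dim≤ I)

dim≥⇒∈ᴵ : (I : Ideal d) → d ≤ dim I → (x : Vec ℕ d) → x ∈ᴵ I
dim≥⇒∈ᴵ (fin _ ∷ I) d<dim _       = contradiction d<dim (<⇒≱ (s≤s (dim≤ I)))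
dim≥⇒∈ᴵ (ω ∷ I)     _     _       zero    = ≤ω-top
dim≥⇒∈ᴵ (ω ∷ I)     d≤dim (_ ∷ x) (suc i) = dim≥⇒∈ᴵ I (≤-pred d≤dim) x i

dim-ω⊆ : (K A : Ideal d) → (∀ c → lookup K c ≡ ω → lookup A c ≡ ω) → dim K ≤ dim A
dim-ω⊆ []          []          _   = z≤n
dim-ω⊆ (fin _ ∷ K) (fin _ ∷ A) ω⊆ = dim-ω⊆ K A (ω⊆ ∘ suc)
dim-ω⊆ (fin _ ∷ K) (ω ∷ A)     ω⊆ = m≤n⇒m≤1+n (dim-ω⊆ K A (ω⊆ ∘ suc))
dim-ω⊆ (ω ∷ K)     (fin _ ∷ A) ω⊆ with () ← ω⊆ zero refl
dim-ω⊆ (ω ∷ K)     (ω ∷ A)     ω⊆ = s≤s (dim-ω⊆ K A (ω⊆ ∘ suc))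

dim-replicate-ω : (n : ℕ) → dim (replicate n ω) ≡ n
dim-replicate-ω zero    = refl
dim-replicate-ω (suc n) = cong suc (dim-replicate-ω n)

free-coordinate : (K A : Ideal d) → dim A < dim K → ∃[ c ] lookup K c ≡ ω × lookup A c ≢ ω
free-coordinate K A dimA<dimK with any? (λ c → (lookup K c ≟ω ω) ×-dec ¬? (lookup A c ≟ω ω))
... | yes free = free
... | no  none = contradiction (dim-ω⊆ K A ω⊆) (<⇒≱ dimA<dimK)
  where
    ω⊆ : ∀ c → lookup K c ≡ ω → lookup A c ≡ ω
    ω⊆ c Kc≡ω = decidable-stable (lookup A c ≟ω ω) (λ Ac≢ω → none (c , Kc≡ω , Ac≢ω))

⊑ᴵ⇒dim≤ : (J K : Ideal d) → J ⊑ᴵ K → dim J ≤ dim K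
⊑ᴵ⇒dim≤ J K J⊑K = dim-ω⊆ J K ω⊆
  where
    ω⊆ : ∀ c → lookup J c ≡ ω → lookup K c ≡ ω
    ω⊆ c Jc≡ω with lookup K c | J⊑K c
    ... | ω | _ = refl
    ... | fin _ | Jc≤Kc with () ← subst (_≤ω _) Jc≡ω Jc≤Kc

dim-update : (K : Ideal d) (c : Fin d) (n : ℕ) → lookup K c ≡ ω → suc (dim (K [ c ]≔ fin n)) ≡ dim K
dim-update (ω ∷ K)     zero    n _     = refl
dim-update (fin _ ∷ K) (suc c) n Kc≡ω = dim-update K c n Kc≡ω
dim-update (ω ∷ K)     (suc c) n Kc≡ω = cong suc (dim-update K c n Kc≡ω)

-- With equal dimensions, J ⊑ K forces the ω's of J and K to coincide.
⊑ᴵ-fin-agree⇒≡ : (J K : Ideal d) → J ⊑ᴵ K → dim K ≤ dim J →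
                 (∀ c {n} → lookup K c ≡ fin n → lookup J c ≡ fin n) → J ≡ K
⊑ᴵ-fin-agree⇒≡ []          []          _   _     _     = refl
⊑ᴵ-fin-agree⇒≡ (a ∷ J)     (fin n ∷ K) J⊑K dim≤ agree with refl ← agree zero refl =
  cong (fin n ∷_) (⊑ᴵ-fin-agree⇒≡ J K (J⊑K ∘ suc) dim≤ (agree ∘ suc))
⊑ᴵ-fin-agree⇒≡ (ω ∷ J)     (ω ∷ K)     J⊑K dim≤ agree =
  cong (ω ∷_) (⊑ᴵ-fin-agree⇒≡ J K (J⊑K ∘ suc) (≤-pred dim≤) (agree ∘ suc))
⊑ᴵ-fin-agree⇒≡ (fin _ ∷ J) (ω ∷ K)     J⊑K dim≤ _     =
  contradiction (⊑ᴵ⇒dim≤ J K (J⊑K ∘ suc)) (<⇒≱ dim≤)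

ωCoords : Ideal d → List (Fin d)
ωCoords []          = []
ωCoords (fin _ ∷ I) = List.map suc (ωCoords I)
ωCoords (ω ∷ I)     = zero ∷ List.map suc (ωCoords I)

length-ωCoords : (I : Ideal d) → length (ωCoords I) ≡ dim I
length-ωCoords []          = refl
length-ωCoords (fin _ ∷ I) = trans (length-map suc (ωCoords I)) (length-ωCoords I)
length-ωCoords (ω ∷ I)     = cong suc (trans (length-map suc (ωCoords I)) (length-ωCoords I))

∈ωCoords⇒≡ω : (I : Ideal d) {c : Fin d} → c ∈ ωCoords I → lookup I c ≡ ω
∈ωCoords⇒≡ω (fin _ ∷ I) c∈ with _ , c′∈ , refl ← ∈-map⁻ suc c∈ = ∈ωCoords⇒≡ω I c′∈
∈ωCoords⇒≡ω (ω ∷ I)     (here refl) = refl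
∈ωCoords⇒≡ω (ω ∷ I)     (there c∈) with _ , c′∈ , refl ← ∈-map⁻ suc c∈ = ∈ωCoords⇒≡ω I c′∈

≡ω⇒∈ωCoords : (I : Ideal d) (c : Fin d) → lookup I c ≡ ω → c ∈ ωCoords I
≡ω⇒∈ωCoords (fin _ ∷ I) (suc c) Ic≡ω = ∈-map⁺ suc (≡ω⇒∈ωCoords I c Ic≡ω)
≡ω⇒∈ωCoords (ω ∷ I)     zero    _    = here refl
≡ω⇒∈ωCoords (ω ∷ I)     (suc c) Ic≡ω = there (∈-map⁺ suc (≡ω⇒∈ωCoords I c Ic≡ω))

-- Ideals of dimension d ∸ j reachable from (ω, …, ω) by fixing, at each step i < j, one more
-- ω-coordinate to a value at most bound (suc i); listed with repetitions.
module Candidates (d : ℕ) (bound : ℕ → ℕ) where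

  refinements : ℕ → Ideal d → List (Ideal d)
  refinements j K =
    cartesianProductWith (λ c n → K [ c ]≔ fin n) (ωCoords K) (upTo (bound (suc j) + 1))

  candidates : ℕ → List (Ideal d)
  candidates zero    = replicate d ω ∷ []
  candidates (suc j) = concatMap (refinements j) (candidates j)

  candidates-dim : ∀ j {K} → K ∈ candidates j → dim K + j ≡ d
  candidates-dim zero    (here refl) = trans (+-identityʳ _) (dim-replicate-ω d)
  candidates-dim (suc j) K∈
    with K′ , K′∈ , K∈′ ← find (∈-concatMap⁻ (refinements j) K∈)
    with c , n , c∈ , _ , refl ← ∈-cartesianProductWith⁻ _ (ωCoords K′) _ K∈′ = begin
      dim (K′ [ c ]≔ fin n) + suc j   ≡⟨ +-suc _ j ⟩
      suc (dim (K′ [ c ]≔ fin n)) + j ≡⟨ cong (_+ j) (dim-update K′ c n (∈ωCoords⇒≡ω K′ c∈)) ⟩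
      dim K′ + j                      ≡⟨ candidates-dim j K′∈ ⟩
      d                               ∎
    where open ≡-Reasoning

  length-candidates-suc : ∀ j → length (candidates (suc j)) ≡
                                length (candidates j) * ((d ∸ j) * (bound (suc j) + 1))
  length-candidates-suc j = length-concatMap (refinements j) (candidates j) length-refinements
    where
      length-refinements : ∀ {K} → K ∈ candidates j →
                           length (refinements j K) ≡ (d ∸ j) * (bound (suc j) + 1)
      length-refinements {K} K∈ = begin
        length (refinements j K)
          ≡⟨ length-cartesianProductWith _ (ωCoords K) (upTo (bound (suc j) + 1)) ⟩
        length (ωCoords K) * length (upTo (bound (suc j) + 1))
          ≡⟨ cong₂ _*_ (length-ωCoords K) (length-upTo _) ⟩
        dim K * (bound (suc j) + 1)
          ≡⟨ cong (_* (bound (suc j) + 1)) (sym (m+n∸n≡m (dim K) j)) ⟩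
        (dim K + j ∸ j) * (bound (suc j) + 1)
          ≡⟨ cong (λ m → (m ∸ j) * (bound (suc j) + 1)) (candidates-dim j K∈) ⟩
        (d ∸ j) * (bound (suc j) + 1) ∎
        where open ≡-Reasoning

  BoundedAncestor : ℕ → Ideal d → Set
  BoundedAncestor j J =
    ∃[ A ] J ⊑ᴵ A × dim A + j < d × (∀ c {n} → lookup A c ≡ fin n → n ≤ bound (suc j))

  record Approximation (J : Ideal d) (j : ℕ) : Set where
    field
      K      : Ideal d
      K∈     : K ∈ candidates j
      J⊑K    : J ⊑ᴵ K
      dimK   : dim K + j ≡ d
      agree  : ∀ c {n} → lookup K c ≡ fin n → lookup J c ≡ fin n

  initial : ∀ {J} → Approximation J zero
  initial {J} = record
    { K     = replicate d ω
    ; K∈    = here refl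
    ; J⊑K   = λ c → subst (lookup J c ≤ω_) (sym (lookup-replicate c ω)) ≤ω-top
    ; dimK  = trans (+-identityʳ _) (dim-replicate-ω d)
    ; agree = λ c Kc≡n → contradiction (trans (sym (lookup-replicate c ω)) Kc≡n) λ ()
    }

  -- The ancestor has more finite coordinates than K, so one of them is still ω in K; copying the
  -- value of J there stays within the bound because J ⊑ A.
  refine : ∀ {J j} → Approximation J j → BoundedAncestor j J → Approximation J (suc j)
  refine {J} {j} record { K = K ; K∈ = K∈ ; J⊑K = J⊑K ; dimK = dimK ; agree = agree }
         (A , J⊑A , dimA , boundA)
    with c , Kc≡ω , Ac≢ω ← free-coordinate K A (+-cancelʳ-< j (dim A) (dim K) (subst (dim A + j <_) (sym dimK) dimA))
    with w , Ac≡w ← ≢ω⇒fin Ac≢ω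
    with u , Jc≡u , u≤w ← ≤ω-fin (subst (lookup J c ≤ω_) Ac≡w (J⊑A c)) = record
    { K     = K′
    ; K∈    = ∈-concatMap⁺ (refinements j) (lose K∈ K′∈refinements)
    ; J⊑K   = ⊑ᴵ-update {I = J} {K} {c} J⊑K (subst (lookup J c ≤ω_) Jc≡u ≤ω-refl)
    ; dimK  = trans (+-suc _ j) (trans (cong (_+ j) (dim-update K c u Kc≡ω)) dimK)
    ; agree = agree′
    }
    where
      K′ = K [ c ]≔ fin u
      K′∈refinements : K′ ∈ refinements j K
      K′∈refinements = ∈-cartesianProductWith⁺ (λ c n → K [ c ]≔ fin n) (≡ω⇒∈ωCoords K c Kc≡ω)
        (∈-upTo⁺ (≤-trans (s≤s (≤-trans u≤w (boundA c Ac≡w))) (≤-reflexive (+-comm 1 _))))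
      agree′ : ∀ c′ {n} → lookup K′ c′ ≡ fin n → lookup J c′ ≡ fin n
      agree′ c′ K′c′≡n with c′ ≟ᶠ c
      ... | yes refl = trans Jc≡u (trans (sym (lookup∘update c K (fin u))) K′c′≡n)
      ... | no  c′≢c = agree c′ (trans (sym (lookup∘update′ c′≢c K (fin u))) K′c′≡n)

  approximation : ∀ {J} m → (∀ j → j < m → BoundedAncestor j J) → Approximation J m
  approximation zero    _         = initial
  approximation (suc m) ancestors =
    refine (approximation m (λ j j<m → ancestors j (m<n⇒m<1+n j<m))) (ancestors m (n<1+n m))

  candidates-complete : ∀ m J → dim J + m ≡ d → (∀ j → j < m → BoundedAncestor j J) →
                        J ∈ candidates m
  candidates-complete m J dimJ ancestors = subst (_∈ candidates m) (sym J≡K) K∈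
    where
      open Approximation (approximation {J} m ancestors)
      J≡K : J ≡ K
      J≡K = ⊑ᴵ-fin-agree⇒≡ J K J⊑K (≤-reflexive (+-cancelʳ-≡ m (dim K) (dim J) (trans dimK (sym dimJ)))) agree

module Chain (D : ℕ → DCS d) (ℓ : ℕ) (chain : DescendingChain D ℓ) where

  ⊆-chain : ∀ {k k′} → k ≤ k′ → k′ ≤ ℓ → ∀ x → x ∈ˢ D k′ → x ∈ˢ D k
  ⊆-chain k≤k′ = go (≤⇒≤′ k≤k′)
    where
      go : ∀ {k k′} → k ≤′ k′ → k′ ≤ ℓ → ∀ x → x ∈ˢ D k′ → x ∈ˢ D k
      go (≤′-reflexive refl)                _    x x∈ = x∈
      go {k′ = suc k′} (≤′-step k≤k′) k′<ℓ x x∈ = go k≤k′ (<⇒≤ k′<ℓ) x (proj₁ (chain k′ k′<ℓ) x x∈)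

  ancestor : ∀ {k k′ J} → k ≤ k′ → k′ ≤ ℓ → J ∈ᶜ D k′ → ∃[ A ] A ∈ᶜ D k × J ⊑ᴵ A
  ancestor {k} {k′} {J} k≤k′ k′≤ℓ J∈ =
    find (⊆⋃⇒⊑ᴵ-any J (ideals (D k)) (λ x x∈J → ⊆-chain k≤k′ k′≤ℓ x (∈ᶜ⇒⊆ (D k′) J∈ x x∈J)))

  proper-exists : ∀ k → k < ℓ → ∃[ I ] Proper D k I
  proper-exists k k<ℓ with _ , (x , x∈ , x∉) ← chain k k<ℓ with I , I∈ , x∈I ← find x∈ =
    I , I∈ , λ I∈′ → x∉ (∈ᶜ⇒⊆ (D (suc k)) I∈′ x x∈I)

  ∈ᶜ-suc⇒dim< : ∀ {k I} → k < ℓ → I ∈ᶜ D (suc k) → dim I < d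
  ∈ᶜ-suc⇒dim< {k} {I} k<ℓ I∈ with _ , (x , _ , x∉) ← chain k k<ℓ with dim I <? d
  ... | yes dim<d = dim<d
  ... | no  dim≮d = contradiction (∈ᶜ⇒⊆ (D (suc k)) I∈ x (dim≥⇒∈ᴵ I (≮⇒≥ dim≮d) x)) x∉

  proper-between : ∀ {k k′ A} → A ∈ᶜ D k → k ≤ k′ → k′ ≤ ℓ → ¬ A ∈ᶜ D k′ →
                   ∃[ s ] k ≤ s × s < k′ × Proper D s A
  proper-between A∈ k≤k′ = go A∈ (≤⇒≤′ k≤k′)
    where
      go : ∀ {k k′ A} → A ∈ᶜ D k → k ≤′ k′ → k′ ≤ ℓ → ¬ A ∈ᶜ D k′ →
           ∃[ s ] k ≤ s × s < k′ × Proper D s A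
      go A∈ (≤′-reflexive refl) _ A∉ = contradiction A∈ A∉
      go {A = A} A∈ (≤′-step {n = k′} k≤k′) k′<ℓ A∉ with A ∈ᶜ? D k′
      ... | yes A∈′ = k′ , ≤′⇒≤ k≤k′ , ≤-refl , A∈′ , A∉
      ... | no  A∉′ with s , k≤s , s<k′ , proper ← go A∈ k≤k′ (<⇒≤ k′<ℓ) A∉′ =
        s , k≤s , m≤n⇒m≤1+n s<k′ , proper

  -- A proper ideal of step s is dominated by an ideal of D (suc s), which in turn lies below an
  -- ideal of D s; by incomparability all three coincide.
  proper⇒∉ᶜ-later : ∀ {s s′ I} → Proper D s I → s < s′ → s′ ≤ ℓ → ¬ I ∈ᶜ D s′
  proper⇒∉ᶜ-later {s} {I = I} (I∈ , I∉) s<s′ s′≤ℓ I∈′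
    with A , A∈ , I⊑A ← ancestor s<s′ s′≤ℓ I∈′
    with B , B∈ , A⊑B ← ancestor (n≤1+n s) (≤-trans s<s′ s′≤ℓ) A∈
    with refl ← ∈ᶜ-antichain (D s) I∈ B∈ (⊑ᴵ-trans {I = I} {A} {B} I⊑A A⊑B) =
    I∉ (subst (_∈ᶜ D (suc s)) (⊑ᴵ-antisym {I = A} {I} A⊑B I⊑A) A∈)

  proper-step-unique : ∀ {s s′ I} → s < ℓ → s′ < ℓ → Proper D s I → Proper D s′ I → s ≡ s′
  proper-step-unique {s} {s′} s<ℓ s′<ℓ proper proper′ with <-cmp s s′
  ... | tri< s<s′ _ _ = contradiction (proj₁ proper′) (proper⇒∉ᶜ-later proper s<s′ (<⇒≤ s′<ℓ))
  ... | tri≈ _ s≡s′ _ = s≡s′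
  ... | tri> _ _ s′<s = contradiction (proj₁ proper) (proper⇒∉ᶜ-later proper′ s′<s (<⇒≤ s<ℓ))

  proper-back : StronglyMonotone D ℓ → ∀ {s k I} → s ≤ k → k < ℓ → Proper D k I →
                ∃[ J ] Proper D s J × dim I ≤ dim J
  proper-back _  {k = zero}  z≤n _ proper = _ , proper , ≤-refl
  proper-back sm {s} {suc k} s≤k k<ℓ proper with s ≤? k
  ... | no  s≰k with refl ← ≤-antisym s≤k (≰⇒> s≰k) = _ , proper , ≤-refl
  ... | yes s≤k′ with I′ , proper′ , dim≤ ← sm k k<ℓ _ proper
                 with J , properJ , dim≤′ ← proper-back sm s≤k′ (<⇒≤ k<ℓ) proper′ =
    J , properJ , ≤-trans dim≤ dim≤′

  DimBound : ℕ → ℕ → Set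
  DimBound t j = ∀ {k I} → t ≤ k → k < ℓ → Proper D k I → dim I + j < d

  ancestor-dim : ∀ {t j s J A} → DimBound t j → t ≤ s → s < ℓ → Proper D s J →
                 A ∈ᶜ D t → J ⊑ᴵ A → dim A + j < d
  ancestor-dim {j = j} {s} {A = A} bound t≤s s<ℓ properJ A∈ J⊑A with A ∈ᶜ? D s
  ... | yes A∈′ = subst (λ K → dim K + j < d) (∈ᶜ-antichain (D s) (proj₁ properJ) A∈′ J⊑A)
                        (bound t≤s s<ℓ properJ)
  ... | no  A∉ with s′ , t≤s′ , s′<s , properA ← proper-between A∈ t≤s (<⇒≤ s<ℓ) A∉ =
    bound t≤s′ (<-trans s′<s s<ℓ) properA

module ChainLength {d} (g : ℕ → ℕ) (n₀ ℓ : ℕ) (D : ℕ → DCS d) (chain : DescendingChain D ℓ)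
                   (strongly-monotone : StronglyMonotone D ℓ) (controlled : Controlled g n₀ D ℓ) where

  open Chain D ℓ chain
  open Candidates d (N d g n₀)

  length-candidates : ∀ j → length (candidates j) ≡ P d g n₀ j
  length-candidates zero    = refl
  length-candidates (suc j) =
    trans (length-candidates-suc j) (cong (_* ((d ∸ j) * (N d g n₀ (suc j) + 1))) (length-candidates j))

  L-mono : ∀ {i j} → i ≤ j → L d g n₀ i ≤ L d g n₀ j
  L-mono i≤j = go (≤⇒≤′ i≤j)
    where
      go : ∀ {i j} → i ≤′ j → L d g n₀ i ≤ L d g n₀ j
      go (≤′-reflexive refl) = ≤-refl
      go (≤′-step i≤j)       = ≤-trans (go i≤j) (m≤m+n _ _)

  coordinate-bound : ∀ {k A c n} → A ∈ᶜ D k → k ≤ ℓ → lookup A c ≡ fin n → n ≤ iter g k n₀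
  coordinate-bound {k} {A} {c} A∈ k≤ℓ Ac≡n =
    ≤-trans (lookup≡fin⇒≤∥∥ᴵ A c Ac≡n) (≤-trans (∈⇒∥∥ᴵ≤max A∈) (controlled k k≤ℓ))

  Claim : ℕ → Set
  Claim i = DimBound (suc (L d g n₀ i)) i

  claim-zero : Claim 0
  claim-zero {suc k} {I} _ k<ℓ (I∈ , _) =
    subst (_< d) (sym (+-identityʳ (dim I))) (∈ᶜ-suc⇒dim< (<-trans (n<1+n k) k<ℓ) I∈)

  -- N (suc j) is iter g (suc (L j)) n₀, exactly the control bound at step L j + 1.
  bounded-ancestor : ∀ {j s J} → Claim j → suc (L d g n₀ j) ≤ s → s < ℓ → Proper D s J →
                     BoundedAncestor j J
  bounded-ancestor claim t≤s s<ℓ properJ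
    with A , A∈ , J⊑A ← ancestor t≤s (<⇒≤ s<ℓ) (proj₁ properJ) =
    A , J⊑A , ancestor-dim claim t≤s s<ℓ properJ A∈ J⊑A ,
    λ c → coordinate-bound A∈ (≤-trans t≤s (<⇒≤ s<ℓ))

  proper∈candidates : ∀ {i s J} → (∀ {j} → j ≤ i → Claim j) → suc (L d g n₀ i) ≤ s → s < ℓ →
                      Proper D s J → dim J + suc i ≡ d → J ∈ candidates (suc i)
  proper∈candidates {i} {J = J} claims t≤s s<ℓ properJ dimJ =
    candidates-complete (suc i) J dimJ λ j j<1+i →
      bounded-ancestor (claims (≤-pred j<1+i)) (≤-trans (s≤s (L-mono (≤-pred j<1+i))) t≤s) s<ℓ properJ

  claim-suc : ∀ i → (∀ {j} → j < suc i → Claim j) → Claim (suc i)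
  claim-suc i claims {k} {I} t≤k k<ℓ properI with dim I + suc i <? d
  ... | yes dim<d = dim<d
  ... | no  dim≮d = contradiction
    (≤-trans (injection⇒≤length family-injective family∈candidates) (≤-reflexive too-many)) (n≮n size)
    where
      t = suc (L d g n₀ i)
      size = P d g n₀ (suc i)

      claim-i : Claim i
      claim-i = claims (n<1+n i)

      dim-exact : ∀ {s J} → t ≤ s → s < ℓ → Proper D s J → dim I ≤ dim J → dim J + suc i ≡ d
      dim-exact t≤s s<ℓ properJ dimI≤dimJ = ≤-antisym
        (≤-trans (≤-reflexive (+-suc _ i)) (claim-i t≤s s<ℓ properJ))
        (≤-trans (≮⇒≥ dim≮d) (+-monoˡ-≤ (suc i) dimI≤dimJ))

      step : Fin (suc size) → ℕ
      step r = t + toℕ r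

      step≤k : ∀ r → step r ≤ k
      step≤k r = ≤-trans (+-monoʳ-≤ t (toℕ≤pred[n] r)) t≤k

      back : ∀ r → ∃[ J ] Proper D (step r) J × dim I ≤ dim J
      back r = proper-back strongly-monotone (step≤k r) k<ℓ properI

      family : Fin (suc size) → Ideal d
      family r = proj₁ (back r)

      family∈candidates : ∀ r → family r ∈ candidates (suc i)
      family∈candidates r with J , properJ , dimI≤dimJ ← back r =
        proper∈candidates (λ j≤i → claims (s≤s j≤i)) (m≤m+n t _) (≤-<-trans (step≤k r) k<ℓ)
          properJ (dim-exact (m≤m+n t _) (≤-<-trans (step≤k r) k<ℓ) properJ dimI≤dimJ)

      family-injective : ∀ {r r′} → family r ≡ family r′ → r ≡ r′
      family-injective {r} {r′} same = toℕ-injective (+-cancelˡ-≡ t _ _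
        (proper-step-unique (≤-<-trans (step≤k r) k<ℓ) (≤-<-trans (step≤k r′) k<ℓ)
          (proj₁ (proj₂ (back r))) (subst (Proper D (step r′)) (sym same) (proj₁ (proj₂ (back r′))))))

      too-many : length (candidates (suc i)) ≡ size
      too-many = length-candidates (suc i)

  claim : ∀ i → Claim i
  claim = <-rec Claim λ { zero _ → claim-zero ; (suc i) claims → claim-suc i claims }

  chain-length≤ : ℓ ≤ L d g n₀ d + 1
  chain-length≤ with ℓ ≤? L d g n₀ d + 1
  ... | yes ℓ≤ = ℓ≤
  ... | no  ℓ≰ with I , properI ← proper-exists (L d g n₀ d + 1) (≰⇒> ℓ≰) =
    contradiction (m≤n+m d (dim I)) (<⇒≱ (claim d (≤-reflexive (+-comm 1 _)) (≰⇒> ℓ≰) properI))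

theorem3p6 : (d : ℕ) → 1 ≤ d → (g : ℕ → ℕ) → Monotone g → Expansive g →
    (n₀ ℓ : ℕ) → (D : ℕ → DCS d) →
    DescendingChain D ℓ → StronglyMonotone D ℓ → Controlled g n₀ D ℓ →
    ℓ ≤ L d g n₀ d + 1
theorem3p6 d _ g _ _ n₀ ℓ D chain strongly-monotone controlled =
  ChainLength.chain-length≤ g n₀ ℓ D chain strongly-monotone controlled
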